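{- Let $\mathbf{A}=(\mathsf{A},\wedge,\vee,\top,\bot,\rightarrow,\leftarrow,\cdot)$ be a residuated basic algebra with lattice order $\leq$. Then for all $a,b,c\in\mathsf{A}$: (i) $(b\vee c)\cdot a\leq (b\cdot a)\vee(c\cdot a)$; (ii) $a\cdot(b\cdot c)\leq (a\cdot b)\cdot c$; (iii) if $a\leq b$, then $c\cdot a\leq c\cdot b$ and $a\cdot c\leq b\cdot c$; (iv) if $a\leq b$, then $c\rightarrow a\leq c\rightarrow b$ and $b\rightarrow c\leq a\rightarrow c$; (v) if $a\leq b$, then $a\leftarrow c\leq b\leftarrow c$ and $c\leftarrow b\leq c\leftarrow a$.
   Context: A residuated basic algebra is an algebra $\mathbf{A}=(\mathsf{A},\wedge,\vee,\top,\bot,\rightarrow,\leftarrow,\cdot)$ such that $(\mathsf{A},\wedge,\vee,\top,\bot)$ is a bounded distributive lattice with lattice order $\leq$, and $\cdot,\rightarrow,\leftarrow$ are binary operations on $\mathsf{A}$ satisfying the residuation law: for all $a,b,c$, $a\cdot b\leq c$ iff $b\leq a\rightarrow c$ iff $a\leq c\leftarrow b$ (the operation $\cdot$ is not assumed associative and has no assumed unit), together with the axioms $a\cdot\top\leq a$, $\top\cdot a\leq a$, and $a\cdot b\leq (a\cdot b)\cdot b$ for all $a,b\in\mathsf{A}$. -}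

module Defs where

open import Level using (Level; _⊔_) renaming (suc to lsuc)
open import Relation.Binary.Core using (Rel)
open import Algebra.Core using (Op₂)
open import Relation.Binary.Lattice.Structures using (IsDistributiveLattice; IsBoundedLattice)

-- A residuated basic algebra: a bounded distributive lattice (given
-- order-theoretically, with setoid equality _≈_ and lattice order _≤_)
-- equipped with binary operations _·_, _⇒_ (the paper's →), _⇐_ (the
-- paper's ←) satisfying residuation and the three extra axioms.
record ResiduatedBasicAlgebra (c ℓ₁ ℓ₂ : Level) : Set (lsuc (c ⊔ ℓ₁ ⊔ ℓ₂)) where
  infix  4 _≈_ _≤_
  infixr 6 _∨_
  infixr 7 _∧_
  infixl 8 _·_
  infixr 5 _⇒_
  infixl 5 _⇐_
  field
    Carrier : Set c
    _≈_     : Rel Carrier ℓ₁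
    _≤_     : Rel Carrier ℓ₂
    _∨_     : Op₂ Carrier
    _∧_     : Op₂ Carrier
    ⊤       : Carrier
    ⊥       : Carrier
    _⇒_     : Op₂ Carrier
    _⇐_     : Op₂ Carrier
    _·_     : Op₂ Carrier
    isDistributiveLattice : IsDistributiveLattice _≈_ _≤_ _∨_ _∧_
    isBoundedLattice      : IsBoundedLattice _≈_ _≤_ _∨_ _∧_ ⊤ ⊥
    res-⇒-to   : ∀ a b c → a · b ≤ c → b ≤ a ⇒ c
    res-⇒-from : ∀ a b c → b ≤ a ⇒ c → a · b ≤ c
    res-⇐-to   : ∀ a b c → a · b ≤ c → a ≤ c ⇐ b
    res-⇐-from : ∀ a b c → a ≤ c ⇐ b → a · b ≤ c
    ·-⊤ʳ      : ∀ a → a · ⊤ ≤ a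
    ·-⊤ˡ      : ∀ a → ⊤ · a ≤ a
    ·-expand  : ∀ a b → a · b ≤ (a · b) · b

module Submission where

open import Defs
open import Level using (Level)
open import Data.Product using (_×_; _,_)
open import Relation.Binary.Structures using (IsPartialOrder)
open import Relation.Binary.Lattice.Structures using (IsDistributiveLattice; IsBoundedLattice)

module ResiduatedBasicAlgebraProperties {c ℓ₁ ℓ₂ : Level} (A : ResiduatedBasicAlgebra c ℓ₁ ℓ₂) where
  open ResiduatedBasicAlgebra A
  open IsDistributiveLattice isDistributiveLattice using (isPartialOrder; x≤x∨y; y≤x∨y; ∨-least)
  open IsPartialOrder isPartialOrder using (refl; trans)
  open IsBoundedLattice isBoundedLattice using (maximum)

  unit-⇒ : ∀ a b → b ≤ a ⇒ a · b
  unit-⇒ a b = res-⇒-to a b (a · b) refl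

  unit-⇐ : ∀ a b → a ≤ a · b ⇐ b
  unit-⇐ a b = res-⇐-to a b (a · b) refl

  counit-⇒ : ∀ a b → a · (a ⇒ b) ≤ b
  counit-⇒ a b = res-⇒-from a (a ⇒ b) b refl

  counit-⇐ : ∀ a b → (b ⇐ a) · a ≤ b
  counit-⇐ a b = res-⇐-from (b ⇐ a) a b refl

  ·-monoʳ-≤ : ∀ {a b} c → a ≤ b → c · a ≤ c · b
  ·-monoʳ-≤ {a} {b} c a≤b = res-⇒-from c a (c · b) (trans a≤b (unit-⇒ c b))

  ·-monoˡ-≤ : ∀ {a b} c → a ≤ b → a · c ≤ b · c
  ·-monoˡ-≤ {a} {b} c a≤b = res-⇐-from a c (b · c) (trans a≤b (unit-⇐ b c))

  ·-mono-≤ : ∀ {a b c d} → a ≤ b → c ≤ d → a · c ≤ b · d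
  ·-mono-≤ {b = b} {c = c} a≤b c≤d = trans (·-monoˡ-≤ c a≤b) (·-monoʳ-≤ b c≤d)

  ⇒-monoʳ-≤ : ∀ {a b} c → a ≤ b → c ⇒ a ≤ c ⇒ b
  ⇒-monoʳ-≤ {a} {b} c a≤b = res-⇒-to c (c ⇒ a) b (trans (counit-⇒ c a) a≤b)

  ⇒-antiˡ-≤ : ∀ {a b} c → a ≤ b → b ⇒ c ≤ a ⇒ c
  ⇒-antiˡ-≤ {a} {b} c a≤b = res-⇒-to a (b ⇒ c) c (trans (·-monoˡ-≤ (b ⇒ c) a≤b) (counit-⇒ b c))

  ⇐-monoˡ-≤ : ∀ {a b} c → a ≤ b → a ⇐ c ≤ b ⇐ c
  ⇐-monoˡ-≤ {a} {b} c a≤b = res-⇐-to (a ⇐ c) c b (trans (counit-⇐ c a) a≤b)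

  ⇐-antiʳ-≤ : ∀ {a b} c → a ≤ b → c ⇐ b ≤ c ⇐ a
  ⇐-antiʳ-≤ {a} {b} c a≤b = res-⇐-to (c ⇐ b) a c (trans (·-monoʳ-≤ (c ⇐ b) a≤b) (counit-⇐ b c))

  -- _· a is a left adjoint (to _⇐ a), so it preserves joins.
  ·-distribʳ-∨ : ∀ a b c → (b ∨ c) · a ≤ (b · a) ∨ (c · a)
  ·-distribʳ-∨ a b c = res-⇐-from (b ∨ c) a _
    (∨-least (res-⇐-to b a _ (x≤x∨y _ _)) (res-⇐-to c a _ (y≤x∨y _ _)))

  ·-decreasingʳ : ∀ a b → a · b ≤ a
  ·-decreasingʳ a b = trans (·-monoʳ-≤ a (maximum b)) (·-⊤ʳ a)

  ·-decreasingˡ : ∀ a b → a · b ≤ b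
  ·-decreasingˡ a b = trans (·-monoˡ-≤ b (maximum a)) (·-⊤ˡ b)

  -- Expand a·(b·c) to (a·(b·c))·(b·c), then shrink the left factor to a·b and the right one to c.
  ·-assoc-≤ : ∀ a b c → a · (b · c) ≤ (a · b) · c
  ·-assoc-≤ a b c = trans (·-expand a (b · c))
    (·-mono-≤ (·-monoʳ-≤ a (·-decreasingʳ b c)) (·-decreasingˡ b c))

proposition1 : ∀ {c ℓ₁ ℓ₂ : Level} (A : ResiduatedBasicAlgebra c ℓ₁ ℓ₂) →
    let open ResiduatedBasicAlgebra A in
    ∀ (a b c : Carrier) →
    ((b ∨ c) · a ≤ (b · a) ∨ (c · a))
    × (a · (b · c) ≤ (a · b) · c)
    × (a ≤ b → (c · a ≤ c · b) × (a · c ≤ b · c))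
    × (a ≤ b → (c ⇒ a ≤ c ⇒ b) × (b ⇒ c ≤ a ⇒ c))
    × (a ≤ b → (a ⇐ c ≤ b ⇐ c) × (c ⇐ b ≤ c ⇐ a))
proposition1 A a b c =
    ·-distribʳ-∨ a b c
  , ·-assoc-≤ a b c
  , (λ a≤b → ·-monoʳ-≤ c a≤b , ·-monoˡ-≤ c a≤b)
  , (λ a≤b → ⇒-monoʳ-≤ c a≤b , ⇒-antiˡ-≤ c a≤b)
  , (λ a≤b → ⇐-monoˡ-≤ c a≤b , ⇐-antiʳ-≤ c a≤b)
  where open ResiduatedBasicAlgebraProperties A
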